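{- Let $\mathcal{M}$ be the set of Motzkin meanders that contain neither $UU$ nor $HD$ as a contiguous subword, and let $S(u)=\sum_{w\in\mathcal{M}} z^{|w|}u^{\mathrm{level}(w)}$. Put $$W=\sqrt{1-2z-z^2+3z^4-2z^5+z^6},\qquad r_1=\frac{1-z-z^2+z^3-W}{2z^2}.$$ Then $$S(u)=\frac{(1+zu)r_1}{z(1-z-uzr_1)},$$ and for every $j\ge1$ the generating function of the meanders in $\mathcal{M}$ ending at level $j$ is $[u^j]S(u)=\frac1{z^2}\Big(\frac{zr_1}{1-z}\Big)^{j+1}+\frac1{z}\Big(\frac{zr_1}{1-z}\Big)^{j}$.
   Context: A Motzkin meander is a finite word $w$ over $\{U,H,D\}$ (heights $+1,0,-1$) all of whose prefixes have nonnegative height sum; $|w|$ is its length and $\mathrm{level}(w)$ its total height sum; the empty word is included; excursions are meanders of level $0$. "Contains $XY$ as a contiguous subword" means two consecutive letters are $X$ then $Y$. Generating functions are formal power series in $z$; $W$ is the formal power series square root with constant term $1$; $[u^j]$ is coefficient extraction. -}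

module Defs where

open import Data.Nat using (ℕ; zero; suc; _∸_)
open import Data.Integer using (ℤ; +_; 0ℤ)
import Data.Integer as Int
import Data.Integer.Properties as IntP
open import Data.Rational using (ℚ; 0ℚ; 1ℚ; _/_) renaming (_+_ to _+ℚ_; _*_ to _*ℚ_; _-_ to _-ℚ_)
open import Data.List using (List; []; _∷_; map; concatMap; zip; drop; inits; length; filter)
open import Data.List.Relation.Unary.All using (All; all?)
open import Data.List.Relation.Unary.Any using (Any; any?)
open import Data.Product using (_×_; _,_)
open import Data.Product.Properties using (≡-dec)
open import Relation.Nullary using (¬_; Dec; yes; no; ¬?)
open import Relation.Nullary.Decidable using (_×-dec_)
open import Relation.Binary.PropositionalEquality using (_≡_; refl)

data Step : Set where
  U H D : Step

_≟S_ : (a b : Step) → Dec (a ≡ b)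
U ≟S U = yes refl
U ≟S H = no λ ()
U ≟S D = no λ ()
H ≟S U = no λ ()
H ≟S H = yes refl
H ≟S D = no λ ()
D ≟S U = no λ ()
D ≟S H = no λ ()
D ≟S D = yes refl

height : Step → ℤ
height U = + 1
height H = + 0
height D = Int.- (+ 1)

level : List Step → ℤ
level []      = 0ℤ
level (s ∷ w) = height s Int.+ level w

IsMeander : List Step → Set
IsMeander w = All (λ p → 0ℤ Int.≤ level p) (inits w)

pairs : List Step → List (Step × Step)
pairs w = zip w (drop 1 w)

Contains : Step → Step → List Step → Set
Contains X Y w = Any (λ p → p ≡ (X , Y)) (pairs w)

InM : List Step → Set
InM w = IsMeander w × (¬ Contains U U w × ¬ Contains H D w)

isMeander? : (w : List Step) → Dec (IsMeander w)
isMeander? w = all? (λ p → 0ℤ IntP.≤? level p) (inits w)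

contains? : (X Y : Step) → (w : List Step) → Dec (Contains X Y w)
contains? X Y w = any? (λ p → ≡-dec _≟S_ _≟S_ p (X , Y)) (pairs w)

inM? : (w : List Step) → Dec (InM w)
inM? w = isMeander? w ×-dec (¬? (contains? U U w) ×-dec ¬? (contains? H D w))

words : ℕ → List (List Step)
words zero    = [] ∷ []
words (suc n) = concatMap (λ w → (U ∷ w) ∷ (H ∷ w) ∷ (D ∷ w) ∷ []) (words n)

countM : ℕ → ℕ → ℕ
countM n k = length (filter (λ w → inM? w ×-dec (level w IntP.≟ + k)) (words n))

FPS : Set
FPS = ℕ → ℚ

-- coefficient of z^n u^k
FPS₂ : Set
FPS₂ = ℕ → ℕ → ℚ

ℕtoℚ : ℕ → ℚ
ℕtoℚ n = + n / 1

sumTo : ℕ → (ℕ → ℚ) → ℚ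
sumTo zero    f = f zero
sumTo (suc n) f = sumTo n f +ℚ f (suc n)

cst : ℚ → FPS
cst c zero    = c
cst c (suc n) = 0ℚ

zS : FPS
zS (suc zero) = 1ℚ
zS _          = 0ℚ

_⊕_ : FPS → FPS → FPS
(f ⊕ g) n = f n +ℚ g n

_⊖_ : FPS → FPS → FPS
(f ⊖ g) n = f n -ℚ g n

_⊛_ : FPS → FPS → FPS
(f ⊛ g) n = sumTo n (λ i → f i *ℚ g (n ∸ i))

infixl 6 _⊕_ _⊖_
infixl 7 _⊛_

_^S_ : FPS → ℕ → FPS
f ^S zero  = cst 1ℚ
f ^S suc j = f ⊛ (f ^S j)

-- 1/(1-z) = Σ z^n
geom : FPS
geom _ = 1ℚ

lift : FPS → FPS₂
lift f n zero    = f n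
lift f n (suc k) = 0ℚ

uB : FPS₂
uB zero (suc zero) = 1ℚ
uB _    _          = 0ℚ

_⊕₂_ : FPS₂ → FPS₂ → FPS₂
(F ⊕₂ G) n k = F n k +ℚ G n k

_⊖₂_ : FPS₂ → FPS₂ → FPS₂
(F ⊖₂ G) n k = F n k -ℚ G n k

_⊛₂_ : FPS₂ → FPS₂ → FPS₂
(F ⊛₂ G) n k = sumTo n (λ i → sumTo k (λ l → F i l *ℚ G (n ∸ i) (k ∸ l)))

infixl 6 _⊕₂_ _⊖₂_
infixl 7 _⊛₂_

Sgf : FPS₂
Sgf n k = ℕtoℚ (countM n k)

Wsq : FPS
Wsq 0 = 1ℚ
Wsq 1 = + 0 / 1 -ℚ (+ 2 / 1)
Wsq 2 = + 0 / 1 -ℚ 1ℚ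
Wsq 4 = + 3 / 1
Wsq 5 = + 0 / 1 -ℚ (+ 2 / 1)
Wsq 6 = 1ℚ
Wsq _ = 0ℚ

Apol : FPS
Apol 0 = 1ℚ
Apol 1 = + 0 / 1 -ℚ 1ℚ
Apol 2 = + 0 / 1 -ℚ 1ℚ
Apol 3 = 1ℚ
Apol _ = 0ℚ

IsW : FPS → Set
IsW W = (∀ n → (W ⊛ W) n ≡ Wsq n) × W 0 ≡ 1ℚ

-- r₁ = (1 - z - z² + z³ - W) / (2z²), stated as 2z²·r₁ = 1 - z - z² + z³ - W
IsR1 : FPS → FPS → Set
IsR1 W r = ∀ n → (cst (+ 2 / 1) ⊛ zS ⊛ zS ⊛ r) n ≡ (Apol ⊖ W) n

{-# OPTIONS --safe #-}

-- Reading a word letter by letter, membership in 𝓜 depends only on the current height and the last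
-- letter. Classifying the meanders of level k by their last letter therefore gives a linear system for
-- S_k = [u^k] S: S_k = [k = 0] + U_k + z S_k + z(1 - z) S_(k+1), where U_(k+1) = z (S_k - U_k).
-- Writing W = A - 2z²r₁ with A = 1 - z - z² + z³ and using A² - W² = 4z³(1 - z), r₁ is the root with
-- r₁(0) = 0 of the kernel equation (1 - z)(1 - z²) r = z² r² + z(1 - z). By the kernel method the
-- defects d₀ = z(1 - z) S₀ - r₁ and d_(k+1) = z(1 - z) S_(k+1) - z² r₁ S_k - [k = 0] z r₁ satisfy
-- r₁ d_(k+2) = d_(k+1) and r₁ d₁ = (1 + z r₁) d₀ modulo the system and the kernel equation; as
-- r₁(0) = 0, this forces every coefficient of every d_k to vanish, by induction on the degree. Both
-- formulas of the theorem are rearrangements of d_k = 0.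

module Submission where

open import Defs

open import Algebra.Bundles using (CommutativeRing)
open import Algebra.Solver.Ring.AlmostCommutativeRing using (fromCommutativeRing; _-Raw-AlmostCommutative⟶_)
import Algebra.Properties.Group as GroupProperties
import Algebra.Solver.Ring as RingSolver
import Algebra.Solver.Ring.Simple as SimpleRingSolver
import Data.Integer as ℤ
open import Data.List using (List; []; _∷_)
open import Data.Maybe using (Maybe; just; nothing)
open import Data.Nat.Induction using (<-rec)
open import Data.Nat as ℕ using (ℕ; zero; suc; _∸_; _≤_; z≤n; s≤s)
import Data.Nat.Coprimality as Coprime
open Coprime using (Coprime)
import Data.Nat.Properties as ℕₚ
open import Data.Product using (_×_; _,_)
import Data.Rational.Properties as ℚₚ
open import Function using (_∘_)
open import Relation.Binary.PropositionalEquality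
  using (_≡_; refl; sym; trans; cong; cong₂; module ≡-Reasoning)
import Relation.Binary.Reasoning.Setoid as SetoidReasoning
open import Relation.Nullary using (yes; no)

module Counting where
  open import Data.Bool using (Bool; true; false; _∧_; not; if_then_else_)
  import Data.Bool.Properties as Boolₚ
  open ℤ using (ℤ; 0ℤ)
  import Data.Integer.Properties as ℤₚ
  open import Data.List using (_∷ʳ_; _++_; concatMap; filter; foldl; inits; length; map)
  open import Data.List.Properties using (foldl-∷ʳ)
  open import Data.List.Relation.Unary.All using (all?)
  import Data.Maybe as Maybe
  open import Data.Nat using (_+_; _≡ᵇ_)
  open import Data.Nat.Tactic.RingSolver using (solve-∀)
  open import Relation.Nullary using (does; _×-dec_)
  open import Relation.Unary using (Pred; Decidable)
  open import Level using (0ℓ)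

  indicator : Bool → ℕ
  indicator true  = 1
  indicator false = 0

  sumList : ∀ {A : Set} → (A → ℕ) → List A → ℕ
  sumList g []       = 0
  sumList g (a ∷ as) = g a + sumList g as

  length-filter≡sumList : ∀ {A : Set} {P : Pred A 0ℓ} (P? : Decidable P) as →
    length (filter P? as) ≡ sumList (indicator ∘ does ∘ P?) as
  length-filter≡sumList P? []       = refl
  length-filter≡sumList P? (a ∷ as) with does (P? a)
  ... | true  = cong suc (length-filter≡sumList P? as)
  ... | false = length-filter≡sumList P? as

  sumList-++ : ∀ {A : Set} (g : A → ℕ) as bs → sumList g (as ++ bs) ≡ sumList g as + sumList g bs
  sumList-++ g []       bs = refl
  sumList-++ g (a ∷ as) bs = trans (cong (g a +_) (sumList-++ g as bs)) (sym (ℕₚ.+-assoc (g a) _ _))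

  sumWords : ℕ → (List Step → ℕ) → ℕ
  sumWords zero    g = g []
  sumWords (suc n) g = sumWords n (g ∘ (U ∷_)) + sumWords n (g ∘ (H ∷_)) + sumWords n (g ∘ (D ∷_))

  sumList-words : ∀ n g → sumList g (words n) ≡ sumWords n g
  sumList-words zero    g = ℕₚ.+-identityʳ (g [])
  sumList-words (suc n) g = begin
    sumList g (concatMap prepend (words n))
      ≡⟨ sumList-concatMap g (words n) ⟩
    sumList (g ∘ (U ∷_)) (words n) + sumList (g ∘ (H ∷_)) (words n) + sumList (g ∘ (D ∷_)) (words n)
      ≡⟨ cong₂ _+_ (cong₂ _+_ (sumList-words n _) (sumList-words n _)) (sumList-words n _) ⟩
    sumWords (suc n) g ∎
    where
    open ≡-Reasoning
    prepend : List Step → List (List Step)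
    prepend w = (U ∷ w) ∷ (H ∷ w) ∷ (D ∷ w) ∷ []
    sumList-concatMap : ∀ g ws → sumList g (concatMap prepend ws)
      ≡ sumList (g ∘ (U ∷_)) ws + sumList (g ∘ (H ∷_)) ws + sumList (g ∘ (D ∷_)) ws
    sumList-concatMap g []       = refl
    sumList-concatMap g (w ∷ ws) = begin
      sumList g (prepend w ++ concatMap prepend ws)
        ≡⟨ sumList-++ g (prepend w) (concatMap prepend ws) ⟩
      (g (U ∷ w) + (g (H ∷ w) + (g (D ∷ w) + 0))) + sumList g (concatMap prepend ws)
        ≡⟨ cong (_ +_) (sumList-concatMap g ws) ⟩
      (g (U ∷ w) + (g (H ∷ w) + (g (D ∷ w) + 0)))
        + (sumList (g ∘ (U ∷_)) ws + sumList (g ∘ (H ∷_)) ws + sumList (g ∘ (D ∷_)) ws)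
        ≡⟨ interchange (g (U ∷ w)) (g (H ∷ w)) (g (D ∷ w)) _ _ _ ⟩
      (g (U ∷ w) + sumList (g ∘ (U ∷_)) ws) + (g (H ∷ w) + sumList (g ∘ (H ∷_)) ws)
        + (g (D ∷ w) + sumList (g ∘ (D ∷_)) ws) ∎
      where
      interchange : ∀ a b c d e f → a + (b + (c + 0)) + (d + e + f) ≡ a + d + (b + e) + (c + f)
      interchange = solve-∀

  sumWords-cong : ∀ n {g h} → (∀ w → g w ≡ h w) → sumWords n g ≡ sumWords n h
  sumWords-cong zero    g≡h = g≡h []
  sumWords-cong (suc n) g≡h =
    cong₂ _+_ (cong₂ _+_ (sumWords-cong n (g≡h ∘ (U ∷_))) (sumWords-cong n (g≡h ∘ (H ∷_))))
              (sumWords-cong n (g≡h ∘ (D ∷_)))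

  sumWords-+ : ∀ n g h → sumWords n (λ w → g w + h w) ≡ sumWords n g + sumWords n h
  sumWords-+ zero    g h = refl
  sumWords-+ (suc n) g h
    rewrite sumWords-+ n (g ∘ (U ∷_)) (h ∘ (U ∷_)) | sumWords-+ n (g ∘ (H ∷_)) (h ∘ (H ∷_))
          | sumWords-+ n (g ∘ (D ∷_)) (h ∘ (D ∷_)) =
    transpose (sumWords n (g ∘ (U ∷_))) (sumWords n (h ∘ (U ∷_))) (sumWords n (g ∘ (H ∷_)))
              (sumWords n (h ∘ (H ∷_))) (sumWords n (g ∘ (D ∷_))) (sumWords n (h ∘ (D ∷_)))
    where
    transpose : ∀ a b c d e f → a + b + (c + d) + (e + f) ≡ a + c + e + (b + d + f)
    transpose = solve-∀

  sumWords-+₃ : ∀ n f g h → sumWords n (λ w → f w + g w + h w) ≡ sumWords n f + sumWords n g + sumWords n h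
  sumWords-+₃ n f g h = trans (sumWords-+ n _ h) (cong (_+ sumWords n h) (sumWords-+ n f g))

  sumWords-0 : ∀ n → sumWords n (λ _ → 0) ≡ 0
  sumWords-0 zero    = refl
  sumWords-0 (suc n) rewrite sumWords-0 n = refl

  sumWords-∷ʳ : ∀ n g → sumWords (suc n) g ≡ sumWords n (λ w → g (w ∷ʳ U) + g (w ∷ʳ H) + g (w ∷ʳ D))
  sumWords-∷ʳ zero    g = refl
  sumWords-∷ʳ (suc n) g =
    cong₂ _+_ (cong₂ _+_ (sumWords-∷ʳ n (g ∘ (U ∷_))) (sumWords-∷ʳ n (g ∘ (H ∷_))))
              (sumWords-∷ʳ n (g ∘ (D ∷_)))

  -- An automaton recognising 𝓜

  data Last : Set where
    none up flat down : Last

  lastOf : Step → Last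
  lastOf U = up
  lastOf H = flat
  lastOf D = down

  sameLast : Last → Last → Bool
  sameLast none none = true
  sameLast up   up   = true
  sameLast flat flat = true
  sameLast down down = true
  sameLast _    _    = false

  -- The height after appending a letter to a word of 𝓜 of height h whose last letter is x, or nothing
  -- if the longer word leaves 𝓜.
  next : Step → ℕ → Last → Maybe ℕ
  next U h       up   = nothing
  next U h       _    = just (suc h)
  next H h       _    = just h
  next D h       flat = nothing
  next D zero    _    = nothing
  next D (suc h) _    = just h

  State : Set
  State = Maybe (ℕ × Last)

  extend : State → Step → State
  extend nothing        s = nothing
  extend (just (h , x)) s = Maybe.map (_, lastOf s) (next s h x)

  run : State → List Step → State
  run = foldl extend

  run-nothing : ∀ w → run nothing w ≡ nothing
  run-nothing []      = refl
  run-nothing (s ∷ w) = run-nothing w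

  endsAtLevel : ℕ → State → Bool
  endsAtLevel k nothing        = false
  endsAtLevel k (just (h , _)) = h ≡ᵇ k

  isNonNegative : ℤ → Bool
  isNonNegative a = does (0ℤ ℤₚ.≤? a)

  meanderFrom : ℤ → List Step → Bool
  meanderFrom a []      = isNonNegative a
  meanderFrom a (s ∷ w) = isNonNegative a ∧ meanderFrom (a ℤ.+ height s) w

  withLast : Last → List Step → List Step
  withLast none w = w
  withLast up   w = U ∷ w
  withLast flat w = H ∷ w
  withLast down w = D ∷ w

  -- The previous letter is put back in front so that a forbidden pair across the boundary is seen.
  avoids : Step → Step → Last → List Step → Bool
  avoids X Y x w = not (does (contains? X Y (withLast x w)))

  reaches : ℕ → List Step → ℕ → Bool
  reaches h w k = does (ℤ.+ h ℤ.+ level w ℤₚ.≟ ℤ.+ k)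

  admissible : ℕ → Last → List Step → ℕ → Bool
  admissible h x w k = (meanderFrom (ℤ.+ h) w ∧ (avoids U U x w ∧ avoids H D x w)) ∧ reaches h w k

  admissible-∷ : ∀ h x s w k h′ → ℤ.+ h ℤ.+ height s ≡ ℤ.+ h′ →
    avoids U U x (s ∷ w) ≡ avoids U U (lastOf s) w → avoids H D x (s ∷ w) ≡ avoids H D (lastOf s) w →
    admissible h x (s ∷ w) k ≡ admissible h′ (lastOf s) w k
  admissible-∷ h x s w k h′ h+s≡h′ uu hd = cong₂ _∧_ (cong₂ _∧_
    (cong (λ a → meanderFrom a w) h+s≡h′) (cong₂ _∧_ uu hd))
    (cong (λ a → does (a ℤₚ.≟ ℤ.+ k))
          (trans (sym (ℤₚ.+-assoc (ℤ.+ h) (height s) (level w))) (cong (ℤ._+ level w) h+s≡h′)))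

  meanderFrom-negative : ∀ n w → meanderFrom (ℤ.-[1+ n ]) w ≡ false
  meanderFrom-negative n []      = refl
  meanderFrom-negative n (s ∷ w) = refl

  up-step : ∀ {h} → ℤ.+ h ℤ.+ height U ≡ ℤ.+ suc h
  up-step {h} = cong ℤ.+_ (ℕₚ.+-comm h 1)

  flat-step : ∀ {h} → ℤ.+ h ℤ.+ height H ≡ ℤ.+ h
  flat-step {h} = cong ℤ.+_ (ℕₚ.+-identityʳ h)

  admissible-run : ∀ h x w k → admissible h x w k ≡ endsAtLevel k (run (just (h , x)) w)
  admissible-run h none [] k rewrite ℕₚ.+-identityʳ h = refl
  admissible-run h up   [] k rewrite ℕₚ.+-identityʳ h = refl
  admissible-run h flat [] k rewrite ℕₚ.+-identityʳ h = refl
  admissible-run h down [] k rewrite ℕₚ.+-identityʳ h = refl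
  admissible-run h none (U ∷ w) k = trans (admissible-∷ h none U w k (suc h) up-step refl refl) (admissible-run (suc h) up w k)
  admissible-run h flat (U ∷ w) k = trans (admissible-∷ h flat U w k (suc h) up-step refl refl) (admissible-run (suc h) up w k)
  admissible-run h down (U ∷ w) k = trans (admissible-∷ h down U w k (suc h) up-step refl refl) (admissible-run (suc h) up w k)
  admissible-run h up   (U ∷ w) k rewrite run-nothing w = cong (_∧ reaches h (U ∷ w) k) (Boolₚ.∧-zeroʳ (meanderFrom _ w))
  admissible-run h none (H ∷ w) k = trans (admissible-∷ h none H w k h flat-step refl refl) (admissible-run h flat w k)
  admissible-run h up   (H ∷ w) k = trans (admissible-∷ h up   H w k h flat-step refl refl) (admissible-run h flat w k)
  admissible-run h flat (H ∷ w) k = trans (admissible-∷ h flat H w k h flat-step refl refl) (admissible-run h flat w k)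
  admissible-run h down (H ∷ w) k = trans (admissible-∷ h down H w k h flat-step refl refl) (admissible-run h flat w k)
  admissible-run h flat (D ∷ w) k rewrite run-nothing w = HD-forbidden (meanderFrom _ w) (avoids U U flat (D ∷ w)) _
    where
    HD-forbidden : ∀ a b c → (a ∧ (b ∧ false)) ∧ c ≡ false
    HD-forbidden false b     c = refl
    HD-forbidden true  false c = refl
    HD-forbidden true  true  c = refl
  admissible-run zero    none (D ∷ w) k rewrite run-nothing w | meanderFrom-negative 0 w = refl
  admissible-run zero    up   (D ∷ w) k rewrite run-nothing w | meanderFrom-negative 0 w = refl
  admissible-run zero    down (D ∷ w) k rewrite run-nothing w | meanderFrom-negative 0 w = refl
  admissible-run (suc h) none (D ∷ w) k = trans (admissible-∷ (suc h) none D w k h refl refl refl) (admissible-run h down w k)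
  admissible-run (suc h) up   (D ∷ w) k = trans (admissible-∷ (suc h) up   D w k h refl refl refl) (admissible-run h down w k)
  admissible-run (suc h) down (D ∷ w) k = trans (admissible-∷ (suc h) down D w k h refl refl refl) (admissible-run h down w k)

  does-all?-cong : ∀ {A : Set} {P Q : Pred A 0ℓ} (P? : Decidable P) (Q? : Decidable Q) →
    (∀ a → does (P? a) ≡ does (Q? a)) → ∀ as → does (all? P? as) ≡ does (all? Q? as)
  does-all?-cong P? Q? P≡Q []       = refl
  does-all?-cong P? Q? P≡Q (a ∷ as) = cong₂ _∧_ (P≡Q a) (does-all?-cong P? Q? P≡Q as)

  does-all?-map : ∀ {A B : Set} {P : Pred A 0ℓ} (P? : Decidable P) (f : B → A) bs →
    does (all? P? (map f bs)) ≡ does (all? (P? ∘ f) bs)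
  does-all?-map P? f []       = refl
  does-all?-map P? f (b ∷ bs) = cong (does (P? (f b)) ∧_) (does-all?-map P? f bs)

  all-prefixes≡meanderFrom : ∀ a w →
    does (all? (λ p → 0ℤ ℤₚ.≤? a ℤ.+ level p) (inits w)) ≡ meanderFrom a w
  all-prefixes≡meanderFrom a [] =
    trans (Boolₚ.∧-identityʳ _) (cong isNonNegative (ℤₚ.+-identityʳ a))
  all-prefixes≡meanderFrom a (s ∷ w) = cong₂ _∧_ (cong isNonNegative (ℤₚ.+-identityʳ a)) (begin
    does (all? (λ p → 0ℤ ℤₚ.≤? a ℤ.+ level p) (map (s ∷_) (inits w)))
      ≡⟨ does-all?-map (λ p → 0ℤ ℤₚ.≤? a ℤ.+ level p) (s ∷_) (inits w) ⟩
    does (all? (λ p → 0ℤ ℤₚ.≤? a ℤ.+ (height s ℤ.+ level p)) (inits w))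
      ≡⟨ does-all?-cong _ _ (λ p → cong isNonNegative (sym (ℤₚ.+-assoc a (height s) (level p)))) (inits w) ⟩
    does (all? (λ p → 0ℤ ℤₚ.≤? a ℤ.+ height s ℤ.+ level p) (inits w))
      ≡⟨ all-prefixes≡meanderFrom (a ℤ.+ height s) w ⟩
    meanderFrom (a ℤ.+ height s) w ∎)
    where open ≡-Reasoning

  run₀ : List Step → State
  run₀ = run (just (0 , none))

  inM-run : ∀ w k → does (inM? w ×-dec (level w ℤₚ.≟ ℤ.+ k)) ≡ endsAtLevel k (run₀ w)
  inM-run w k = trans
    (cong₂ (λ a b → (a ∧ (avoids U U none w ∧ avoids H D none w)) ∧ b)
      (trans (does-all?-cong _ _ (λ p → cong isNonNegative (sym (ℤₚ.+-identityˡ (level p)))) (inits w))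
             (all-prefixes≡meanderFrom (ℤ.+ 0) w))
      (cong (λ b → does (b ℤₚ.≟ ℤ.+ k)) (sym (ℤₚ.+-identityˡ (level w)))))
    (admissible-run 0 none w k)

  endsIn : ℕ → Last → State → ℕ
  endsIn k x nothing        = 0
  endsIn k x (just (h , y)) = indicator (sameLast y x ∧ (h ≡ᵇ k))

  countEnding : ℕ → ℕ → Last → ℕ
  countEnding n k x = sumWords n (λ w → endsIn k x (run₀ w))

  indicator-endsAtLevel : ∀ k m →
    indicator (endsAtLevel k m) ≡ endsIn k none m + endsIn k up m + endsIn k flat m + endsIn k down m
  indicator-endsAtLevel k nothing           = refl
  indicator-endsAtLevel k (just (h , none)) =
    sym (trans (ℕₚ.+-identityʳ _) (trans (ℕₚ.+-identityʳ _) (ℕₚ.+-identityʳ _)))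
  indicator-endsAtLevel k (just (h , up))   = sym (trans (ℕₚ.+-identityʳ _) (ℕₚ.+-identityʳ _))
  indicator-endsAtLevel k (just (h , flat)) = sym (ℕₚ.+-identityʳ _)
  indicator-endsAtLevel k (just (h , down)) = refl

  countM≡sumWords : ∀ n k → countM n k ≡ sumWords n (λ w → indicator (endsAtLevel k (run₀ w)))
  countM≡sumWords n k = trans (length-filter≡sumList (λ w → inM? w ×-dec (level w ℤₚ.≟ ℤ.+ k)) (words n))
    (trans (sumList-words n _) (sumWords-cong n λ w → cong indicator (inM-run w k)))

  countM-split : ∀ n k →
    countM n k ≡ countEnding n k none + countEnding n k up + countEnding n k flat + countEnding n k down
  countM-split n k = begin
    countM n k
      ≡⟨ countM≡sumWords n k ⟩
    sumWords n (λ w → indicator (endsAtLevel k (run₀ w)))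
      ≡⟨ sumWords-cong n (indicator-endsAtLevel k ∘ run₀) ⟩
    sumWords n (λ w → ending none w + ending up w + ending flat w + ending down w)
      ≡⟨ sumWords-+ n _ (ending down) ⟩
    sumWords n (λ w → ending none w + ending up w + ending flat w) + countEnding n k down
      ≡⟨ cong (_+ countEnding n k down) (sumWords-+ n _ (ending flat)) ⟩
    sumWords n (λ w → ending none w + ending up w) + countEnding n k flat + countEnding n k down
      ≡⟨ cong (λ c → c + countEnding n k flat + countEnding n k down) (sumWords-+ n (ending none) (ending up)) ⟩
    countEnding n k none + countEnding n k up + countEnding n k flat + countEnding n k down ∎
    where
    open ≡-Reasoning
    ending : Last → List Step → ℕ
    ending x w = endsIn k x (run₀ w)

  hits : ℕ → Maybe ℕ → ℕ
  hits k nothing  = 0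
  hits k (just h) = indicator (h ≡ᵇ k)

  arrivals : Step → ℕ → State → ℕ
  arrivals s k nothing        = 0
  arrivals s k (just (h , y)) = hits k (next s h y)

  endsIn-extend : ∀ k x m s → endsIn k x (extend m s) ≡ (if sameLast (lastOf s) x then arrivals s k m else 0)
  endsIn-extend k x nothing        s = sym (if-0 (sameLast (lastOf s) x))
    where
    if-0 : ∀ b → (if b then 0 else 0) ≡ 0
    if-0 true  = refl
    if-0 false = refl
  endsIn-extend k x (just (h , y)) s with next s h y
  ... | nothing = sym (if-0 (sameLast (lastOf s) x))
    where
    if-0 : ∀ b → (if b then 0 else 0) ≡ 0
    if-0 true  = refl
    if-0 false = refl
  ... | just h′ = indicator-∧ (sameLast (lastOf s) x) (h′ ≡ᵇ k)
    where
    indicator-∧ : ∀ b c → indicator (b ∧ c) ≡ (if b then indicator c else 0)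
    indicator-∧ true  c = refl
    indicator-∧ false c = refl

  endsIn-run-∷ʳ : ∀ k x w t →
    endsIn k x (run₀ (w ∷ʳ t)) ≡ (if sameLast (lastOf t) x then arrivals t k (run₀ w) else 0)
  endsIn-run-∷ʳ k x w t =
    trans (cong (endsIn k x) (foldl-∷ʳ extend (just (0 , none)) t w)) (endsIn-extend k x (run₀ w) t)

  countEnding-suc : ∀ n k x → countEnding (suc n) k x ≡ sumWords n (λ w →
      (if sameLast up x then arrivals U k (run₀ w) else 0) + (if sameLast flat x then arrivals H k (run₀ w) else 0)
    + (if sameLast down x then arrivals D k (run₀ w) else 0))
  countEnding-suc n k x = trans (sumWords-∷ʳ n (λ w → endsIn k x (run₀ w))) (sumWords-cong n λ w →
    cong₂ _+_ (cong₂ _+_ (endsIn-run-∷ʳ k x w U) (endsIn-run-∷ʳ k x w H)) (endsIn-run-∷ʳ k x w D))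

  countEnding-none : ∀ n k → countEnding (suc n) k none ≡ 0
  countEnding-none n k = trans (countEnding-suc n k none) (sumWords-0 n)

  countEnding-lastOf : ∀ n k s → countEnding (suc n) k (lastOf s) ≡ sumWords n (λ w → arrivals s k (run₀ w))
  countEnding-lastOf n k U =
    trans (countEnding-suc n k up) (sumWords-cong n λ w → trans (ℕₚ.+-identityʳ _) (ℕₚ.+-identityʳ _))
  countEnding-lastOf n k H = trans (countEnding-suc n k flat) (sumWords-cong n λ w → ℕₚ.+-identityʳ _)
  countEnding-lastOf n k D = countEnding-suc n k down

  arrivals-U-zero : ∀ m → arrivals U 0 m ≡ 0
  arrivals-U-zero nothing           = refl
  arrivals-U-zero (just (h , none)) = refl
  arrivals-U-zero (just (h , up))   = refl
  arrivals-U-zero (just (h , flat)) = refl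
  arrivals-U-zero (just (h , down)) = refl

  arrivals-U-suc : ∀ k m → arrivals U (suc k) m ≡ endsIn k none m + endsIn k flat m + endsIn k down m
  arrivals-U-suc k nothing           = refl
  arrivals-U-suc k (just (h , none)) = sym (trans (ℕₚ.+-identityʳ _) (ℕₚ.+-identityʳ _))
  arrivals-U-suc k (just (h , up))   = refl
  arrivals-U-suc k (just (h , flat)) = sym (ℕₚ.+-identityʳ _)
  arrivals-U-suc k (just (h , down)) = refl

  arrivals-H : ∀ k m → arrivals H k m ≡ indicator (endsAtLevel k m)
  arrivals-H k nothing        = refl
  arrivals-H k (just (h , y)) = refl

  arrivals-D : ∀ k m → arrivals D k m ≡ endsIn (suc k) none m + endsIn (suc k) up m + endsIn (suc k) down m
  arrivals-D k nothing                 = refl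
  arrivals-D k (just (h , flat))       = refl
  arrivals-D k (just (zero , none))    = refl
  arrivals-D k (just (zero , up))      = refl
  arrivals-D k (just (zero , down))    = refl
  arrivals-D k (just (suc h , none))   = sym (trans (ℕₚ.+-identityʳ _) (ℕₚ.+-identityʳ _))
  arrivals-D k (just (suc h , up))     = sym (ℕₚ.+-identityʳ _)
  arrivals-D k (just (suc h , down))   = refl

  countEnding-up-zero : ∀ n → countEnding (suc n) 0 up ≡ 0
  countEnding-up-zero n = trans (countEnding-lastOf n 0 U)
    (trans (sumWords-cong n (arrivals-U-zero ∘ run₀)) (sumWords-0 n))

  countEnding-up-suc : ∀ n k →
    countEnding (suc n) (suc k) up ≡ countEnding n k none + countEnding n k flat + countEnding n k down
  countEnding-up-suc n k = trans (countEnding-lastOf n (suc k) U)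
    (trans (sumWords-cong n (arrivals-U-suc k ∘ run₀)) (sumWords-+₃ n _ _ _))

  countEnding-flat : ∀ n k → countEnding (suc n) k flat ≡ countM n k
  countEnding-flat n k = trans (countEnding-lastOf n k H)
    (trans (sumWords-cong n (arrivals-H k ∘ run₀)) (sym (countM≡sumWords n k)))

  countEnding-down : ∀ n k →
    countEnding (suc n) k down ≡ countEnding n (suc k) none + countEnding n (suc k) up + countEnding n (suc k) down
  countEnding-down n k = trans (countEnding-lastOf n k D)
    (trans (sumWords-cong n (arrivals-D k ∘ run₀)) (sumWords-+₃ n _ _ _))

open import Data.Rational using (ℚ; mkℚ; 0ℚ; 1ℚ; _+_; _*_; -_; _-_; _≟_; _/_)

module ℚ-Solver = SimpleRingSolver (fromCommutativeRing ℚₚ.+-*-commutativeRing) _≟_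

sumTo-cong : ∀ n {f g : ℕ → ℚ} → (∀ i → i ℕ.≤ n → f i ≡ g i) → sumTo n f ≡ sumTo n g
sumTo-cong zero    f≡g = f≡g 0 z≤n
sumTo-cong (suc n) f≡g =
  cong₂ _+_ (sumTo-cong n λ i i≤n → f≡g i (ℕₚ.m≤n⇒m≤1+n i≤n)) (f≡g (suc n) ℕₚ.≤-refl)

sumTo-+ : ∀ n (f g : ℕ → ℚ) → sumTo n (λ i → f i + g i) ≡ sumTo n f + sumTo n g
sumTo-+ zero    f g = refl
sumTo-+ (suc n) f g = trans (cong (_+ (f (suc n) + g (suc n))) (sumTo-+ n f g))
  (solve 4 (λ a b c d → (a :+ b) :+ (c :+ d) := (a :+ c) :+ (b :+ d)) refl
     (sumTo n f) (sumTo n g) (f (suc n)) (g (suc n)))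
  where open ℚ-Solver

sumTo-*ˡ : ∀ n c (f : ℕ → ℚ) → sumTo n (λ i → c * f i) ≡ c * sumTo n f
sumTo-*ˡ zero    c f = refl
sumTo-*ˡ (suc n) c f =
  trans (cong (_+ c * f (suc n)) (sumTo-*ˡ n c f)) (sym (ℚₚ.*-distribˡ-+ c (sumTo n f) (f (suc n))))

sumTo-zero : ∀ n (f : ℕ → ℚ) → (∀ i → i ℕ.≤ n → f i ≡ 0ℚ) → sumTo n f ≡ 0ℚ
sumTo-zero n f f≡0 = trans (sumTo-cong n f≡0) (sumTo-const0 n)
  where
  sumTo-const0 : ∀ n → sumTo n (λ _ → 0ℚ) ≡ 0ℚ
  sumTo-const0 zero    = refl
  sumTo-const0 (suc n) = cong (_+ 0ℚ) (sumTo-const0 n)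

sumTo-suc : ∀ n (f : ℕ → ℚ) → sumTo (suc n) f ≡ f 0 + sumTo n (f ∘ suc)
sumTo-suc zero    f = refl
sumTo-suc (suc n) f = trans (cong (_+ f (suc (suc n))) (sumTo-suc n f)) (ℚₚ.+-assoc (f 0) _ _)

sumTo-reverse : ∀ n (f : ℕ → ℚ) → sumTo n f ≡ sumTo n (λ i → f (n ∸ i))
sumTo-reverse zero    f = refl
sumTo-reverse (suc n) f = begin
  sumTo (suc n) f                                   ≡⟨ sumTo-suc n f ⟩
  f 0 + sumTo n (f ∘ suc)                           ≡⟨ cong (f 0 +_) (sumTo-reverse n (f ∘ suc)) ⟩
  f 0 + sumTo n (λ i → f (suc (n ∸ i)))             ≡⟨ ℚₚ.+-comm (f 0) _ ⟩
  sumTo n (λ i → f (suc (n ∸ i))) + f 0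
    ≡⟨ cong₂ _+_ (sumTo-cong n λ i i≤n → cong f (sym (ℕₚ.+-∸-assoc 1 i≤n))) (cong f (sym (ℕₚ.n∸n≡0 n))) ⟩
  sumTo (suc n) (λ i → f (suc n ∸ i))               ∎
  where open ≡-Reasoning

sumTo-comm : ∀ n k (h : ℕ → ℕ → ℚ) →
  sumTo n (λ i → sumTo k (h i)) ≡ sumTo k (λ l → sumTo n (λ i → h i l))
sumTo-comm zero    k h = refl
sumTo-comm (suc n) k h =
  trans (cong (_+ sumTo k (h (suc n))) (sumTo-comm n k h)) (sym (sumTo-+ k _ (h (suc n))))

sumTo-last : ∀ k (f : ℕ → ℚ) → (∀ l → l ℕ.< k → f l ≡ 0ℚ) → sumTo k f ≡ f k
sumTo-last zero    f _   = refl
sumTo-last (suc k) f f≡0 =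
  trans (cong (_+ f (suc k)) (sumTo-zero k f λ i i≤k → f≡0 i (s≤s i≤k))) (ℚₚ.+-identityˡ _)

sumTo-first : ∀ k (f : ℕ → ℚ) → (∀ l → f (suc l) ≡ 0ℚ) → sumTo k f ≡ f 0
sumTo-first zero    f _   = refl
sumTo-first (suc k) f f≡0 =
  trans (sumTo-suc k f) (trans (cong (f 0 +_) (sumTo-zero k (f ∘ suc) λ i _ → f≡0 i)) (ℚₚ.+-identityʳ _))

infix 4 _≐_
_≐_ : FPS → FPS → Set
f ≐ g = ∀ n → f n ≡ g n

⊝_ : FPS → FPS
(⊝ f) n = - f n

scale : ℚ → FPS → FPS
scale c f n = c * f n

tailS : FPS → FPS
tailS f n = f (suc n)

⊛-suc : ∀ f g n → (f ⊛ g) (suc n) ≡ f 0 * g (suc n) + (tailS f ⊛ g) n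
⊛-suc f g n = sumTo-suc n (λ i → f i * g (suc n ∸ i))

⊛-congʳ : ∀ {f f′} g → f ≐ f′ → f ⊛ g ≐ f′ ⊛ g
⊛-congʳ g f≐f′ n = sumTo-cong n λ i _ → cong (_* g (n ∸ i)) (f≐f′ i)

⊛-congˡ : ∀ f {g g′} → g ≐ g′ → f ⊛ g ≐ f ⊛ g′
⊛-congˡ f g≐g′ n = sumTo-cong n λ i _ → cong (f i *_) (g≐g′ (n ∸ i))

⊕-congʳ : ∀ h {f f′} → f ≐ f′ → f ⊕ h ≐ f′ ⊕ h
⊕-congʳ h f≐f′ n = cong (_+ h n) (f≐f′ n)

⊛-comm : ∀ f g → f ⊛ g ≐ g ⊛ f
⊛-comm f g n = trans (sumTo-reverse n (λ i → f i * g (n ∸ i)))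
  (sumTo-cong n λ i i≤n → trans (cong (λ m → f (n ∸ i) * g m) (ℕₚ.m∸[m∸n]≡n i≤n)) (ℚₚ.*-comm (f (n ∸ i)) (g i)))

⊛-distribʳ-⊕ : ∀ f g h → (g ⊕ h) ⊛ f ≐ g ⊛ f ⊕ h ⊛ f
⊛-distribʳ-⊕ f g h n =
  trans (sumTo-cong n λ i _ → ℚₚ.*-distribʳ-+ (f (n ∸ i)) (g i) (h i)) (sumTo-+ n _ _)

⊛-scaleˡ : ∀ c f g → scale c f ⊛ g ≐ scale c (f ⊛ g)
⊛-scaleˡ c f g n = trans (sumTo-cong n λ i _ → ℚₚ.*-assoc c (f i) (g (n ∸ i))) (sumTo-*ˡ n c _)

⊛-vanishˡ : ∀ f g → (∀ n → f n ≡ 0ℚ) → ∀ n → (f ⊛ g) n ≡ 0ℚ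
⊛-vanishˡ f g f≡0 n = sumTo-zero n _ λ i _ → trans (cong (_* g (n ∸ i)) (f≡0 i)) (ℚₚ.*-zeroˡ (g (n ∸ i)))

⊛-vanishʳ : ∀ f g → (∀ n → g n ≡ 0ℚ) → ∀ n → (f ⊛ g) n ≡ 0ℚ
⊛-vanishʳ f g g≡0 n = trans (⊛-comm f g n) (⊛-vanishˡ g f g≡0 n)

cst-⊛ : ∀ c f → cst c ⊛ f ≐ scale c f
cst-⊛ c f zero    = refl
cst-⊛ c f (suc n) =
  trans (⊛-suc (cst c) f n)
        (trans (cong (c * f (suc n) +_) (⊛-vanishˡ (tailS (cst c)) f (λ _ → refl) n)) (ℚₚ.+-identityʳ _))

⊛-identityˡ : ∀ f → cst 1ℚ ⊛ f ≐ f
⊛-identityˡ f n = trans (cst-⊛ 1ℚ f n) (ℚₚ.*-identityˡ (f n))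

⊛-assoc : ∀ f g h → (f ⊛ g) ⊛ h ≐ f ⊛ (g ⊛ h)
⊛-assoc f g h zero    = ℚₚ.*-assoc (f 0) (g 0) (h 0)
⊛-assoc f g h (suc n) = begin
  ((f ⊛ g) ⊛ h) (suc n)
    ≡⟨ ⊛-suc (f ⊛ g) h n ⟩
  f 0 * g 0 * h (suc n) + (tailS (f ⊛ g) ⊛ h) n
    ≡⟨ cong (f 0 * g 0 * h (suc n) +_) (begin
         (tailS (f ⊛ g) ⊛ h) n                        ≡⟨ ⊛-congʳ h (⊛-suc f g) n ⟩
         ((scale (f 0) (tailS g) ⊕ tailS f ⊛ g) ⊛ h) n ≡⟨ ⊛-distribʳ-⊕ h (scale (f 0) (tailS g)) (tailS f ⊛ g) n ⟩
         (scale (f 0) (tailS g) ⊛ h) n + ((tailS f ⊛ g) ⊛ h) n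
           ≡⟨ cong₂ _+_ (⊛-scaleˡ (f 0) (tailS g) h n) (⊛-assoc (tailS f) g h n) ⟩
         f 0 * (tailS g ⊛ h) n + (tailS f ⊛ (g ⊛ h)) n ∎) ⟩
  f 0 * g 0 * h (suc n) + (f 0 * (tailS g ⊛ h) n + (tailS f ⊛ (g ⊛ h)) n)
    ≡⟨ solve 5 (λ a b c d e → a :* b :* c :+ (a :* d :+ e) := a :* (b :* c :+ d) :+ e) refl
         (f 0) (g 0) (h (suc n)) ((tailS g ⊛ h) n) ((tailS f ⊛ (g ⊛ h)) n) ⟩
  f 0 * (g 0 * h (suc n) + (tailS g ⊛ h) n) + (tailS f ⊛ (g ⊛ h)) n
    ≡⟨ cong (λ x → f 0 * x + (tailS f ⊛ (g ⊛ h)) n) (sym (⊛-suc g h n)) ⟩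
  f 0 * (g ⊛ h) (suc n) + (tailS f ⊛ (g ⊛ h)) n
    ≡⟨ sym (⊛-suc f (g ⊛ h) n) ⟩
  (f ⊛ (g ⊛ h)) (suc n) ∎
  where
  open ≡-Reasoning
  open ℚ-Solver

fpsCommutativeRing : CommutativeRing _ _
fpsCommutativeRing = record
  { Carrier = FPS ; _≈_ = _≐_ ; _+_ = _⊕_ ; _*_ = _⊛_ ; -_ = ⊝_ ; 0# = cst 0ℚ ; 1# = cst 1ℚ
  ; isCommutativeRing = record
    { isRing = record
      { +-isAbelianGroup = record
        { isGroup = record
          { isMonoid = record
            { isSemigroup = record
              { isMagma = record
                { isEquivalence = record
                  { refl = λ _ → refl ; sym = λ e n → sym (e n) ; trans = λ e e′ n → trans (e n) (e′ n) }
                ; ∙-cong = λ e e′ n → cong₂ _+_ (e n) (e′ n) }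
              ; assoc = λ f g h n → ℚₚ.+-assoc (f n) (g n) (h n) }
            ; identity = (λ f → λ { zero → ℚₚ.+-identityˡ (f 0) ; (suc n) → ℚₚ.+-identityˡ (f (suc n)) })
                       , (λ f → λ { zero → ℚₚ.+-identityʳ (f 0) ; (suc n) → ℚₚ.+-identityʳ (f (suc n)) }) }
          ; inverse = (λ f → λ { zero → ℚₚ.+-inverseˡ (f 0) ; (suc n) → ℚₚ.+-inverseˡ (f (suc n)) })
                    , (λ f → λ { zero → ℚₚ.+-inverseʳ (f 0) ; (suc n) → ℚₚ.+-inverseʳ (f (suc n)) })
          ; ⁻¹-cong = λ e n → cong -_ (e n) }
        ; comm = λ f g n → ℚₚ.+-comm (f n) (g n) }
      ; *-cong = λ {f} {f′} {g} e e′ n → trans (⊛-congʳ g e n) (⊛-congˡ f′ e′ n)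
      ; *-assoc = ⊛-assoc
      ; *-identity = ⊛-identityˡ , λ f n → trans (⊛-comm f (cst 1ℚ) n) (⊛-identityˡ f n)
      ; distrib = (λ f g h n → trans (⊛-comm f (g ⊕ h) n) (trans (⊛-distribʳ-⊕ f g h n)
                                  (cong₂ _+_ (⊛-comm g f n) (⊛-comm h f n))))
                , ⊛-distribʳ-⊕ }
    ; *-comm = ⊛-comm } }

cst-homomorphism : CommutativeRing.rawRing ℚₚ.+-*-commutativeRing
                     -Raw-AlmostCommutative⟶ fromCommutativeRing fpsCommutativeRing
cst-homomorphism = record
  { ⟦_⟧    = cst
  ; +-homo = λ a b → λ { zero → refl ; (suc n) → refl }
  ; *-homo = λ a b n → sym (trans (cst-⊛ a (cst b) n) (cst-scale a b n))
  ; -‿homo = λ a → λ { zero → refl ; (suc n) → refl }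
  ; 0-homo = λ { zero → refl ; (suc n) → refl }
  ; 1-homo = λ { zero → refl ; (suc n) → refl }
  }
  where
  cst-scale : ∀ a b → scale a (cst b) ≐ cst (a * b)
  cst-scale a b zero    = refl
  cst-scale a b (suc n) = ℚₚ.*-zeroʳ a

open CommutativeRing fpsCommutativeRing public using ()
  renaming (refl to ≐-refl; sym to ≐-sym; trans to ≐-trans; +-cong to ⊕-cong; *-cong to ⊛-cong)

module ≐-Reasoning = SetoidReasoning (CommutativeRing.setoid fpsCommutativeRing)

cst-0 : ∀ n → cst 0ℚ n ≡ 0ℚ
cst-0 zero    = refl
cst-0 (suc n) = refl

x≐y⇒x⊖y≡0 : ∀ {f g} → f ≐ g → ∀ n → (f ⊖ g) n ≡ 0ℚ
x≐y⇒x⊖y≡0 {f} {g} f≐g n = trans (cong (_- g n) (f≐g n)) (ℚₚ.+-inverseʳ (g n))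

cst-≟ : (a b : ℚ) → Maybe (cst a ≐ cst b)
cst-≟ a b with a ≟ b
... | yes refl = just λ _ → refl
... | no  _    = nothing

module FPS-Solver = RingSolver (CommutativeRing.rawRing ℚₚ.+-*-commutativeRing)
  (fromCommutativeRing fpsCommutativeRing) cst-homomorphism cst-≟

zS⊛-zero : ∀ f → (zS ⊛ f) 0 ≡ 0ℚ
zS⊛-zero f = ℚₚ.*-zeroˡ (f 0)

zS⊛-suc : ∀ f n → (zS ⊛ f) (suc n) ≡ f n
zS⊛-suc f n = begin
  (zS ⊛ f) (suc n)                        ≡⟨ ⊛-suc zS f n ⟩
  0ℚ * f (suc n) + (tailS zS ⊛ f) n       ≡⟨ cong₂ _+_ (ℚₚ.*-zeroˡ (f (suc n))) (⊛-congʳ f tail-zS n) ⟩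
  0ℚ + (cst 1ℚ ⊛ f) n                     ≡⟨ trans (ℚₚ.+-identityˡ _) (⊛-identityˡ f n) ⟩
  f n                                     ∎
  where
  open ≡-Reasoning
  tail-zS : tailS zS ≐ cst 1ℚ
  tail-zS zero    = refl
  tail-zS (suc n) = refl

⊛-vanish-below : ∀ f g n → f 0 ≡ 0ℚ → (∀ {m} → m ℕ.< n → g m ≡ 0ℚ) → (f ⊛ g) n ≡ 0ℚ
⊛-vanish-below f g zero    f₀≡0 _    = trans (cong (_* g 0) f₀≡0) (ℚₚ.*-zeroˡ (g 0))
⊛-vanish-below f g (suc n) f₀≡0 g≡0 = sumTo-zero (suc n) _ term≡0
  where
  term≡0 : ∀ i → i ℕ.≤ suc n → f i * g (suc n ∸ i) ≡ 0ℚ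
  term≡0 zero    _ = trans (cong (_* g (suc n)) f₀≡0) (ℚₚ.*-zeroˡ (g (suc n)))
  term≡0 (suc i) _ = trans (cong (f (suc i) *_) (g≡0 (s≤s (ℕₚ.m∸n≤m n i)))) (ℚₚ.*-zeroʳ (f (suc i)))

coeffs : List ℚ → FPS
coeffs []       _       = 0ℚ
coeffs (a ∷ as) zero    = a
coeffs (a ∷ as) (suc n) = coeffs as n

horner : List ℚ → FPS
horner []       = cst 0ℚ
horner (a ∷ as) = cst a ⊕ zS ⊛ horner as

horner≐coeffs : ∀ as → horner as ≐ coeffs as
horner≐coeffs []       zero    = refl
horner≐coeffs []       (suc n) = refl
horner≐coeffs (a ∷ as) zero    = trans (cong (a +_) (zS⊛-zero (horner as))) (ℚₚ.+-identityʳ a)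
horner≐coeffs (a ∷ as) (suc n) =
  trans (ℚₚ.+-identityˡ _) (trans (zS⊛-suc (horner as) n) (horner≐coeffs as n))

2ℚ 3ℚ 4ℚ : ℚ
2ℚ = ℤ.+ 2 / 1
3ℚ = ℤ.+ 3 / 1
4ℚ = ℤ.+ 4 / 1

Apol-coeffs : List ℚ
Apol-coeffs = 1ℚ ∷ - 1ℚ ∷ - 1ℚ ∷ 1ℚ ∷ []

Wsq-coeffs : List ℚ
Wsq-coeffs = 1ℚ ∷ - 2ℚ ∷ - 1ℚ ∷ 0ℚ ∷ 3ℚ ∷ - 2ℚ ∷ 1ℚ ∷ []

Apol≐horner : Apol ≐ horner Apol-coeffs
Apol≐horner n = trans (Apol≐coeffs n) (sym (horner≐coeffs Apol-coeffs n))
  where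
  Apol≐coeffs : Apol ≐ coeffs Apol-coeffs
  Apol≐coeffs 0 = refl
  Apol≐coeffs 1 = refl
  Apol≐coeffs 2 = refl
  Apol≐coeffs 3 = refl
  Apol≐coeffs (suc (suc (suc (suc n)))) = refl

Wsq≐horner : Wsq ≐ horner Wsq-coeffs
Wsq≐horner n = trans (Wsq≐coeffs n) (sym (horner≐coeffs Wsq-coeffs n))
  where
  Wsq≐coeffs : Wsq ≐ coeffs Wsq-coeffs
  Wsq≐coeffs 0 = refl
  Wsq≐coeffs 1 = refl
  Wsq≐coeffs 2 = refl
  Wsq≐coeffs 3 = refl
  Wsq≐coeffs 4 = refl
  Wsq≐coeffs 5 = refl
  Wsq≐coeffs 6 = refl
  Wsq≐coeffs (suc (suc (suc (suc (suc (suc (suc n))))))) = refl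

1-z : FPS
1-z = cst 1ℚ ⊖ zS

geom⊛1-z : geom ⊛ 1-z ≐ cst 1ℚ
geom⊛1-z zero          = refl
geom⊛1-z (suc zero)    = refl
geom⊛1-z (suc (suc n)) = trans (⊛-suc geom 1-z (suc n)) (cong (1ℚ * 0ℚ +_) (geom⊛1-z (suc n)))

-- ⟦ hornerₚ as z ⟧ is definitionally horner as, so the ring solver can work with Apol and Wsq.
module _ where
  open FPS-Solver using (Polynomial; con; _:+_; _:*_)

  hornerₚ : ∀ {m} → List ℚ → Polynomial m → Polynomial m
  hornerₚ []       x = con 0ℚ
  hornerₚ (a ∷ as) x = con a :+ x :* hornerₚ as x

IsKernelRoot : FPS → Set
IsKernelRoot r = 1-z ⊛ (cst 1ℚ ⊖ zS ⊛ zS) ⊛ r ≐ zS ⊛ zS ⊛ r ⊛ r ⊕ zS ⊛ 1-z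

kernelDefect : FPS → FPS
kernelDefect r = 1-z ⊛ (cst 1ℚ ⊖ zS ⊛ zS) ⊛ r ⊖ (zS ⊛ zS ⊛ r ⊛ r ⊕ zS ⊛ 1-z)

square-expansion : ∀ r → let B = horner Apol-coeffs ⊖ cst 2ℚ ⊛ zS ⊛ zS ⊛ r in
  horner Wsq-coeffs ⊖ B ⊛ B ≐ cst 4ℚ ⊛ zS ⊛ zS ⊛ kernelDefect r
square-expansion = solve 2 (λ z r → let b = hornerₚ Apol-coeffs z :- con 2ℚ :* z :* z :* r in
    hornerₚ Wsq-coeffs z :- b :* b
  := con 4ℚ :* z :* z :* ((con 1ℚ :- z) :* (con 1ℚ :- z :* z) :* r :- (z :* z :* r :* r :+ z :* (con 1ℚ :- z))))
  (λ _ → refl) zS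
  where open FPS-Solver

cancel-4z² : ∀ f → cst 4ℚ ⊛ zS ⊛ zS ⊛ f ≐ cst 0ℚ → f ≐ cst 0ℚ
cancel-4z² f 4z²f≐0 n = begin
  f n                                            ≡⟨ quarter-of-four (f n) ⟩
  ℤ.+ 1 / 4 * (4ℚ * f n)                         ≡⟨ cong (ℤ.+ 1 / 4 *_) (sym (cst-⊛ 4ℚ f n)) ⟩
  ℤ.+ 1 / 4 * (cst 4ℚ ⊛ f) n                     ≡⟨ cong (ℤ.+ 1 / 4 *_) (sym (z²⊛-coeff n)) ⟩
  ℤ.+ 1 / 4 * (cst 4ℚ ⊛ zS ⊛ zS ⊛ f) (suc (suc n)) ≡⟨ cong (ℤ.+ 1 / 4 *_) (4z²f≐0 (suc (suc n))) ⟩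
  ℤ.+ 1 / 4 * 0ℚ                                 ≡⟨ ℚₚ.*-zeroʳ (ℤ.+ 1 / 4) ⟩
  0ℚ                                             ≡⟨ cst-0 n ⟨
  cst 0ℚ n                                       ∎
  where
  open ≡-Reasoning
  z²⊛-coeff : ∀ m → (cst 4ℚ ⊛ zS ⊛ zS ⊛ f) (suc (suc m)) ≡ (cst 4ℚ ⊛ f) m
  z²⊛-coeff m = trans (FPS-Solver.solve 3 (λ c z x → c :* z :* z :* x := z :* (z :* (c :* x))) (λ _ → refl)
                         (cst 4ℚ) zS f (suc (suc m)))
                      (trans (zS⊛-suc (zS ⊛ (cst 4ℚ ⊛ f)) (suc m)) (zS⊛-suc (cst 4ℚ ⊛ f) m))
    where open FPS-Solver using (_:*_; _:=_)
  quarter-of-four : ∀ x → x ≡ ℤ.+ 1 / 4 * (4ℚ * x)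
  quarter-of-four = ℚ-Solver.solve 1 (λ x → x := con (ℤ.+ 1 / 4) :* (con 4ℚ :* x)) refl
    where open ℚ-Solver

open GroupProperties (CommutativeRing.+-group fpsCommutativeRing) using ()
  renaming (x∙y⁻¹≈ε⇒x≈y to x⊖y≐0⇒x≐y)

kernel-root : ∀ W r → IsW W → IsR1 W r → IsKernelRoot r
kernel-root W r (W²≐Wsq , _) 2z²r≐A-W = x⊖y≐0⇒x≐y _ _ (cancel-4z² (kernelDefect r) (begin
  cst 4ℚ ⊛ zS ⊛ zS ⊛ kernelDefect r         ≈⟨ ≐-sym (square-expansion r) ⟩
  horner Wsq-coeffs ⊖ (A ⊖ T) ⊛ (A ⊖ T)
    ≈⟨ (λ n → cong₂ _-_ (sym (Wsq≐horner n)) (⊛-cong (≐-sym W≐A-T) (≐-sym W≐A-T) n)) ⟩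
  Wsq ⊖ W ⊛ W
    ≈⟨ (λ n → trans (cong (λ x → Wsq n - x) (W²≐Wsq n)) (trans (ℚₚ.+-inverseʳ (Wsq n)) (sym (cst-0 n)))) ⟩
  cst 0ℚ ∎))
  where
  open ≐-Reasoning
  A T : FPS
  A = horner Apol-coeffs
  T = cst 2ℚ ⊛ zS ⊛ zS ⊛ r
  W≐A-T : W ≐ A ⊖ T
  W≐A-T n = trans (ℚ-Solver.solve 2 (λ a w → w := a :- (a :- w)) refl (Apol n) (W n))
                  (cong₂ _-_ (Apol≐horner n) (sym (2z²r≐A-W n)))
    where open ℚ-Solver

kernelRoot-zero : ∀ {r} → IsKernelRoot r → r 0 ≡ 0ℚ
kernelRoot-zero {r} root = begin
  r 0                                   ≡⟨ solve 1 (λ x → x := con 1ℚ :* con 1ℚ :* x) refl (r 0) ⟩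
  (1-z ⊛ (cst 1ℚ ⊖ zS ⊛ zS) ⊛ r) 0      ≡⟨ root 0 ⟩
  (zS ⊛ zS ⊛ r ⊛ r ⊕ zS ⊛ 1-z) 0
    ≡⟨ solve 1 (λ x → con 0ℚ :* con 0ℚ :* x :* x :+ con 0ℚ :* con 1ℚ := con 0ℚ) refl (r 0) ⟩
  0ℚ                                    ∎
  where
  open ≡-Reasoning
  open ℚ-Solver

-- Solving the last-step equations by the kernel method

ε : ℕ → FPS
ε zero    = cst 1ℚ
ε (suc k) = cst 0ℚ

-- A meander of level k ends with nothing (k = 0), with U, with H appended to any meander of level k,
-- or with D appended to a meander of level k + 1 not ending in H (a series S_(k+1) - z S_(k+1)).
-- Those ending in U are a U appended to a level k - 1 meander that does not itself end in U.
endingWithU : (ℕ → FPS) → ℕ → FPS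
endingWithU S zero    = cst 0ℚ
endingWithU S (suc k) = zS ⊛ (ε k ⊕ zS ⊛ S k ⊕ zS ⊛ 1-z ⊛ S (suc k))

LastStepEquations : (ℕ → FPS) → Set
LastStepEquations S = ∀ k → S k ≐ ε k ⊕ endingWithU S k ⊕ zS ⊛ S k ⊕ zS ⊛ 1-z ⊛ S (suc k)

KernelSolution : (ℕ → FPS) → FPS → Set
KernelSolution S r = (zS ⊛ 1-z ⊛ S 0 ≐ r)
                   × (∀ k → zS ⊛ 1-z ⊛ S (suc k) ≐ zS ⊛ zS ⊛ r ⊛ S k ⊕ zS ⊛ r ⊛ ε k)

module _ (S : ℕ → FPS) (r : FPS) (root : IsKernelRoot r) (equations : LastStepEquations S) where
  private
    open ≡-Reasoning

    solutionDefect : ℕ → FPS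
    solutionDefect zero    = zS ⊛ 1-z ⊛ S 0 ⊖ r
    solutionDefect (suc k) = zS ⊛ 1-z ⊛ S (suc k) ⊖ (zS ⊛ zS ⊛ r ⊛ S k ⊕ zS ⊛ r ⊛ ε k)

    recurrenceDefect : ℕ → FPS
    recurrenceDefect k = S k ⊖ (ε k ⊕ endingWithU S k ⊕ zS ⊛ S k ⊕ zS ⊛ 1-z ⊛ S (suc k))

    r⊛solutionDefect-one : r ⊛ solutionDefect 1 ≐
      solutionDefect 0 ⊕ zS ⊛ r ⊛ solutionDefect 0 ⊕ (S 0 ⊛ kernelDefect r ⊖ r ⊛ recurrenceDefect 0)
    r⊛solutionDefect-one = solve 4 (λ r z s₀ s₁ →
        r :* (z :* (con 1ℚ :- z) :* s₁ :- (z :* z :* r :* s₀ :+ z :* r :* con 1ℚ))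
      := (z :* (con 1ℚ :- z) :* s₀ :- r) :+ z :* r :* (z :* (con 1ℚ :- z) :* s₀ :- r)
         :+ (s₀ :* ((con 1ℚ :- z) :* (con 1ℚ :- z :* z) :* r :- (z :* z :* r :* r :+ z :* (con 1ℚ :- z)))
             :- r :* (s₀ :- (con 1ℚ :+ con 0ℚ :+ z :* s₀ :+ z :* (con 1ℚ :- z) :* s₁))))
      ≐-refl r zS (S 0) (S 1)
      where open FPS-Solver

    r⊛solutionDefect-suc : ∀ k → r ⊛ solutionDefect (suc (suc k)) ≐
      solutionDefect (suc k) ⊕ (S (suc k) ⊛ kernelDefect r ⊖ r ⊛ recurrenceDefect (suc k))
    r⊛solutionDefect-suc k = solve 6 (λ r z e s₀ s₁ s₂ →
        r :* (z :* (con 1ℚ :- z) :* s₂ :- (z :* z :* r :* s₁ :+ z :* r :* con 0ℚ))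
      := (z :* (con 1ℚ :- z) :* s₁ :- (z :* z :* r :* s₀ :+ z :* r :* e))
         :+ (s₁ :* ((con 1ℚ :- z) :* (con 1ℚ :- z :* z) :* r :- (z :* z :* r :* r :+ z :* (con 1ℚ :- z)))
             :- r :* (s₁ :- (con 0ℚ :+ z :* (e :+ z :* s₀ :+ z :* (con 1ℚ :- z) :* s₁)
                             :+ z :* s₁ :+ z :* (con 1ℚ :- z) :* s₂))))
      ≐-refl r zS (ε k) (S k) (S (suc k)) (S (suc (suc k)))
      where open FPS-Solver

    errors-vanish : ∀ k n → (S k ⊛ kernelDefect r ⊖ r ⊛ recurrenceDefect k) n ≡ 0ℚ
    errors-vanish k n = cong₂ _-_ (⊛-vanishʳ (S k) (kernelDefect r) (x≐y⇒x⊖y≡0 root) n)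
                                  (⊛-vanishʳ r (recurrenceDefect k) (x≐y⇒x⊖y≡0 (equations k)) n)

    solutionDefect-vanishes : ∀ n k → solutionDefect k n ≡ 0ℚ
    solutionDefect-vanishes = <-rec _ vanishes-at
      where
      r₀≡0 : r 0 ≡ 0ℚ
      r₀≡0 = kernelRoot-zero {r} root
      vanishes-at : ∀ n → (∀ {m} → m ℕ.< n → ∀ k → solutionDefect k m ≡ 0ℚ) → ∀ k → solutionDefect k n ≡ 0ℚ
      vanishes-at n below zero = begin
        solutionDefect 0 n
          ≡⟨ solve 1 (λ x → x := x :+ con 0ℚ :+ con 0ℚ) refl (solutionDefect 0 n) ⟩
        solutionDefect 0 n + 0ℚ + 0ℚ
          ≡⟨ cong₂ (λ x y → solutionDefect 0 n + x + y)
               (sym (⊛-vanish-below (zS ⊛ r) (solutionDefect 0) n (zS⊛-zero r) (λ m<n → below m<n 0)))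
               (sym (errors-vanish 0 n)) ⟩
        (solutionDefect 0 ⊕ zS ⊛ r ⊛ solutionDefect 0 ⊕ (S 0 ⊛ kernelDefect r ⊖ r ⊛ recurrenceDefect 0)) n
          ≡⟨ sym (r⊛solutionDefect-one n) ⟩
        (r ⊛ solutionDefect 1) n
          ≡⟨ ⊛-vanish-below r (solutionDefect 1) n r₀≡0 (λ m<n → below m<n 1) ⟩
        0ℚ ∎
        where open ℚ-Solver
      vanishes-at n below (suc k) = begin
        solutionDefect (suc k) n
          ≡⟨ sym (ℚₚ.+-identityʳ _) ⟩
        solutionDefect (suc k) n + 0ℚ
          ≡⟨ cong (solutionDefect (suc k) n +_) (sym (errors-vanish (suc k) n)) ⟩
        (solutionDefect (suc k) ⊕ (S (suc k) ⊛ kernelDefect r ⊖ r ⊛ recurrenceDefect (suc k))) n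
          ≡⟨ sym (r⊛solutionDefect-suc k n) ⟩
        (r ⊛ solutionDefect (suc (suc k))) n
          ≡⟨ ⊛-vanish-below r (solutionDefect (suc (suc k))) n r₀≡0 (λ m<n → below m<n (suc (suc k))) ⟩
        0ℚ ∎

    solutionDefect≐0 : ∀ k → solutionDefect k ≐ cst 0ℚ
    solutionDefect≐0 k n = trans (solutionDefect-vanishes n k) (sym (cst-0 n))

  kernel-method : KernelSolution S r
  kernel-method = x⊖y≐0⇒x≐y _ _ (solutionDefect≐0 0) , λ k → x⊖y≐0⇒x≐y _ _ (solutionDefect≐0 (suc k))

divide-by-1-z : ∀ f g → zS ⊛ 1-z ⊛ f ≐ g → zS ⊛ zS ⊛ f ≐ geom ⊛ zS ⊛ g
divide-by-1-z f g z[1-z]f≐g = begin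
  zS ⊛ zS ⊛ f                        ≈⟨ ≐-sym (⊛-identityˡ (zS ⊛ zS ⊛ f)) ⟩
  cst 1ℚ ⊛ (zS ⊛ zS ⊛ f)             ≈⟨ ⊛-congʳ (zS ⊛ zS ⊛ f) (≐-sym geom⊛1-z) ⟩
  geom ⊛ 1-z ⊛ (zS ⊛ zS ⊛ f)
    ≈⟨ solve 3 (λ g z f → g :* (con 1ℚ :- z) :* (z :* z :* f) := g :* z :* (z :* (con 1ℚ :- z) :* f)) ≐-refl geom zS f ⟩
  geom ⊛ zS ⊛ (zS ⊛ 1-z ⊛ f)         ≈⟨ ⊛-congˡ (geom ⊛ zS) z[1-z]f≐g ⟩
  geom ⊛ zS ⊛ g                      ∎
  where
  open ≐-Reasoning
  open FPS-Solver

level-formula : ∀ {S r} → KernelSolution S r → ∀ i →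
  zS ⊛ zS ⊛ S (suc i) ≐ (zS ⊛ r ⊛ geom) ^S suc (suc i) ⊕ zS ⊛ (zS ⊛ r ⊛ geom) ^S suc i
level-formula {S} {r} (level₀ , level-suc) = λ i → begin
  zS ⊛ zS ⊛ S (suc i)                      ≈⟨ level-recurrence i ⟩
  x ⊛ (zS ⊛ zS ⊛ S i) ⊕ zS ⊛ x ⊛ ε i       ≈⟨ powers i ⟩
  x ^S suc (suc i) ⊕ zS ⊛ x ^S suc i       ∎
  where
  open ≐-Reasoning
  open FPS-Solver
  x : FPS
  x = zS ⊛ r ⊛ geom
  level-recurrence : ∀ k → zS ⊛ zS ⊛ S (suc k) ≐ x ⊛ (zS ⊛ zS ⊛ S k) ⊕ zS ⊛ x ⊛ ε k
  level-recurrence k = ≐-trans (divide-by-1-z (S (suc k)) _ (level-suc k))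
    (solve 5 (λ g z r s e → g :* z :* (z :* z :* r :* s :+ z :* r :* e)
                          := z :* r :* g :* (z :* z :* s) :+ z :* (z :* r :* g) :* e)
       ≐-refl geom zS r (S k) (ε k))
  powers : ∀ i → x ⊛ (zS ⊛ zS ⊛ S i) ⊕ zS ⊛ x ⊛ ε i ≐ x ^S suc (suc i) ⊕ zS ⊛ x ^S suc i
  powers zero = ≐-trans (⊕-congʳ (zS ⊛ x ⊛ ε 0) (⊛-congˡ x (≐-trans (divide-by-1-z (S 0) r level₀)
                  (solve 3 (λ g z r → g :* z :* r := z :* r :* g) ≐-refl geom zS r))))
    (solve 2 (λ x z → x :* x :+ z :* x :* con 1ℚ := x :^ 2 :+ z :* x :^ 1) ≐-refl x zS)
  powers (suc i) = ≐-trans (⊕-congʳ (zS ⊛ x ⊛ ε (suc i)) (⊛-congˡ x (≐-trans (level-recurrence i) (powers i))))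
    (solve 4 (λ x z p q → x :* (p :+ z :* q) :+ z :* x :* con 0ℚ := x :* p :+ z :* (x :* q))
       ≐-refl x zS (x ^S suc (suc i)) (x ^S suc i))

-- Bivariate series as sequences of coefficients of powers of u

uCoeff : FPS₂ → ℕ → FPS
uCoeff F k n = F n k

uCoeff-⊛₂ : ∀ F G k n → uCoeff (F ⊛₂ G) k n ≡ sumTo k (λ l → (uCoeff F l ⊛ uCoeff G (k ∸ l)) n)
uCoeff-⊛₂ F G k n = sumTo-comm n k (λ i l → F i l * G (n ∸ i) (k ∸ l))

uCoeff-⊛₂-lift : ∀ F g k → uCoeff (F ⊛₂ lift g) k ≐ uCoeff F k ⊛ g
uCoeff-⊛₂-lift F g k n = begin
  uCoeff (F ⊛₂ lift g) k n                                   ≡⟨ uCoeff-⊛₂ F (lift g) k n ⟩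
  sumTo k (λ l → (uCoeff F l ⊛ uCoeff (lift g) (k ∸ l)) n)  ≡⟨ sumTo-last k _ (λ l l<k →
                                                                  ⊛-vanishʳ (uCoeff F l) _ (lift-vanishes l<k) n) ⟩
  (uCoeff F k ⊛ uCoeff (lift g) (k ∸ k)) n                   ≡⟨ ⊛-congˡ (uCoeff F k) (λ m → cong (lift g m) (ℕₚ.n∸n≡0 k)) n ⟩
  (uCoeff F k ⊛ g) n                                         ∎
  where
  open ≡-Reasoning
  lift-vanishes : ∀ {l k} → l ℕ.< k → ∀ m → uCoeff (lift g) (k ∸ l) m ≡ 0ℚ
  lift-vanishes {zero}  {suc k} _         m = refl
  lift-vanishes {suc l} {suc k} (s≤s l<k) m = lift-vanishes l<k m

uCoeff-lift-⊛₂ : ∀ g F k → uCoeff (lift g ⊛₂ F) k ≐ g ⊛ uCoeff F k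
uCoeff-lift-⊛₂ g F k n = trans (uCoeff-⊛₂ (lift g) F k n)
  (sumTo-first k _ λ l → ⊛-vanishˡ (uCoeff (lift g) (suc l)) (uCoeff F (k ∸ suc l)) (λ _ → refl) n)

uCoeff-uB-zero : ∀ n → uCoeff uB 0 n ≡ 0ℚ
uCoeff-uB-zero zero    = refl
uCoeff-uB-zero (suc n) = refl

uCoeff-uB-suc : ∀ k → uCoeff uB (suc k) ≐ ε k
uCoeff-uB-suc zero    zero    = refl
uCoeff-uB-suc zero    (suc n) = refl
uCoeff-uB-suc (suc k) zero    = refl
uCoeff-uB-suc (suc k) (suc n) = refl

uCoeff-uB⊛₂-zero : ∀ F n → uCoeff (uB ⊛₂ F) 0 n ≡ 0ℚ
uCoeff-uB⊛₂-zero F n = ⊛-vanishˡ (uCoeff uB 0) (uCoeff F 0) uCoeff-uB-zero n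

uCoeff-uB⊛₂-suc : ∀ F k → uCoeff (uB ⊛₂ F) (suc k) ≐ uCoeff F k
uCoeff-uB⊛₂-suc F k n = begin
  uCoeff (uB ⊛₂ F) (suc k) n
    ≡⟨ uCoeff-⊛₂ uB F (suc k) n ⟩
  sumTo (suc k) (λ l → (uCoeff uB l ⊛ uCoeff F (suc k ∸ l)) n)
    ≡⟨ sumTo-suc k _ ⟩
  (uCoeff uB 0 ⊛ uCoeff F (suc k)) n + sumTo k (λ l → (uCoeff uB (suc l) ⊛ uCoeff F (k ∸ l)) n)
    ≡⟨ cong₂ _+_ (⊛-vanishˡ (uCoeff uB 0) (uCoeff F (suc k)) uCoeff-uB-zero n)
                 (sumTo-first k _ λ l → ⊛-vanishˡ (uCoeff uB (suc (suc l))) (uCoeff F (k ∸ suc l))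
                                                   (λ m → trans (uCoeff-uB-suc (suc l) m) (cst-0 m)) n) ⟩
  0ℚ + (uCoeff uB 1 ⊛ uCoeff F k) n
    ≡⟨ trans (ℚₚ.+-identityˡ _) (⊛-congʳ (uCoeff F k) (uCoeff-uB-suc 0) n) ⟩
  (cst 1ℚ ⊛ uCoeff F k) n
    ≡⟨ ⊛-identityˡ (uCoeff F k) n ⟩
  uCoeff F k n ∎
  where open ≡-Reasoning

uCoeff-⊛₂-linear-suc : ∀ F G → (∀ j n → uCoeff G (suc (suc j)) n ≡ 0ℚ) → ∀ k →
  uCoeff (F ⊛₂ G) (suc k) ≐ uCoeff F k ⊛ uCoeff G 1 ⊕ uCoeff F (suc k) ⊛ uCoeff G 0
uCoeff-⊛₂-linear-suc F G G-linear k n = begin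
  uCoeff (F ⊛₂ G) (suc k) n
    ≡⟨ uCoeff-⊛₂ F G (suc k) n ⟩
  sumTo k (λ l → (uCoeff F l ⊛ uCoeff G (suc k ∸ l)) n) + (uCoeff F (suc k) ⊛ uCoeff G (suc k ∸ suc k)) n
    ≡⟨ cong₂ _+_ (sumTo-last k _ λ l l<k → ⊛-vanishʳ (uCoeff F l) _ (high-vanishes l<k) n)
                 (cong (λ i → (uCoeff F (suc k) ⊛ uCoeff G i) n) (ℕₚ.n∸n≡0 k)) ⟩
  (uCoeff F k ⊛ uCoeff G (suc k ∸ k)) n + (uCoeff F (suc k) ⊛ uCoeff G 0) n
    ≡⟨ cong (λ i → (uCoeff F k ⊛ uCoeff G i) n + (uCoeff F (suc k) ⊛ uCoeff G 0) n) (ℕₚ.m+n∸n≡m 1 k) ⟩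
  (uCoeff F k ⊛ uCoeff G 1) n + (uCoeff F (suc k) ⊛ uCoeff G 0) n ∎
  where
  open ≡-Reasoning
  high-vanishes : ∀ {l k} → l ℕ.< k → ∀ m → uCoeff G (suc k ∸ l) m ≡ 0ℚ
  high-vanishes {zero}  {suc k} _         m = G-linear k m
  high-vanishes {suc l} {suc k} (s≤s l<k) m = high-vanishes l<k m

functional-equation : ∀ F r → KernelSolution (uCoeff F) r → ∀ n k →
  (lift zS ⊛₂ F ⊛₂ (lift (cst 1ℚ) ⊖₂ lift zS ⊖₂ uB ⊛₂ lift zS ⊛₂ lift r)) n k
    ≡ ((lift (cst 1ℚ) ⊕₂ lift zS ⊛₂ uB) ⊛₂ lift r) n k
functional-equation F r (level₀ , level-suc) n k = trans (lhs k n) (sym (rhs k n))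
  where
  open ≐-Reasoning
  open FPS-Solver using (solve; _:=_; _:+_; _:*_; _:-_; :-_; con)
  S : ℕ → FPS
  S = uCoeff F

  kernel : FPS₂
  kernel = lift (cst 1ℚ) ⊖₂ lift zS ⊖₂ uB ⊛₂ lift zS ⊛₂ lift r

  ur-coeff : ∀ k n → uCoeff (uB ⊛₂ lift zS ⊛₂ lift r) k n ≡ (uCoeff (uB ⊛₂ lift zS) k ⊛ r) n
  ur-coeff k = uCoeff-⊛₂-lift (uB ⊛₂ lift zS) r k

  kernel-zero : uCoeff kernel 0 ≐ 1-z
  kernel-zero n = trans (cong (λ x → 1-z n - x) (trans (ur-coeff 0 n) (⊛-vanishˡ _ r (uCoeff-uB⊛₂-zero (lift zS)) n)))
                        (ℚₚ.+-identityʳ (1-z n))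

  kernel-one : uCoeff kernel 1 ≐ ⊝ (zS ⊛ r)
  kernel-one n = trans (ℚₚ.+-identityˡ _) (cong -_ (trans (ur-coeff 1 n) (⊛-congʳ r (uCoeff-uB⊛₂-suc (lift zS) 0) n)))

  kernel-high : ∀ j n → uCoeff kernel (suc (suc j)) n ≡ 0ℚ
  kernel-high j n = cong (λ x → 0ℚ - 0ℚ - x)
    (trans (ur-coeff (suc (suc j)) n) (⊛-vanishˡ _ r (λ m → uCoeff-uB⊛₂-suc (lift zS) (suc j) m) n))

  value : ℕ → FPS
  value zero    = r
  value (suc k) = zS ⊛ ε k ⊛ r

  lhs : ∀ k → uCoeff (lift zS ⊛₂ F ⊛₂ kernel) k ≐ value k
  lhs zero = begin
    uCoeff (lift zS ⊛₂ F ⊛₂ kernel) 0       ≈⟨ uCoeff-⊛₂ (lift zS ⊛₂ F) kernel 0 ⟩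
    uCoeff (lift zS ⊛₂ F) 0 ⊛ uCoeff kernel 0 ≈⟨ ⊛-cong (uCoeff-lift-⊛₂ zS F 0) kernel-zero ⟩
    zS ⊛ S 0 ⊛ 1-z
      ≈⟨ solve 2 (λ z s → z :* s :* (con 1ℚ :- z) := z :* (con 1ℚ :- z) :* s) ≐-refl zS (S 0) ⟩
    zS ⊛ 1-z ⊛ S 0                          ≈⟨ level₀ ⟩
    r                                       ∎
  lhs (suc k) = begin
    uCoeff (lift zS ⊛₂ F ⊛₂ kernel) (suc k)
      ≈⟨ uCoeff-⊛₂-linear-suc (lift zS ⊛₂ F) kernel kernel-high k ⟩
    uCoeff (lift zS ⊛₂ F) k ⊛ uCoeff kernel 1 ⊕ uCoeff (lift zS ⊛₂ F) (suc k) ⊛ uCoeff kernel 0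
      ≈⟨ ⊕-cong (⊛-cong (uCoeff-lift-⊛₂ zS F k) kernel-one) (⊛-cong (uCoeff-lift-⊛₂ zS F (suc k)) kernel-zero) ⟩
    zS ⊛ S k ⊛ (⊝ (zS ⊛ r)) ⊕ zS ⊛ S (suc k) ⊛ 1-z
      ≈⟨ solve 4 (λ z r s s′ → z :* s :* (:- (z :* r)) :+ z :* s′ :* (con 1ℚ :- z)
                             := z :* (con 1ℚ :- z) :* s′ :- z :* z :* r :* s) ≐-refl zS r (S k) (S (suc k)) ⟩
    zS ⊛ 1-z ⊛ S (suc k) ⊖ zS ⊛ zS ⊛ r ⊛ S k
      ≈⟨ (λ n → cong (_- (zS ⊛ zS ⊛ r ⊛ S k) n) (level-suc k n)) ⟩
    zS ⊛ zS ⊛ r ⊛ S k ⊕ zS ⊛ r ⊛ ε k ⊖ zS ⊛ zS ⊛ r ⊛ S k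
      ≈⟨ solve 4 (λ z r s e → z :* z :* r :* s :+ z :* r :* e :- z :* z :* r :* s := z :* e :* r) ≐-refl zS r (S k) (ε k) ⟩
    zS ⊛ ε k ⊛ r ∎

  1+zu : FPS₂
  1+zu = lift (cst 1ℚ) ⊕₂ lift zS ⊛₂ uB

  rhs : ∀ k → uCoeff (1+zu ⊛₂ lift r) k ≐ value k
  rhs zero n = trans (uCoeff-⊛₂-lift 1+zu r 0 n) (trans (⊛-congʳ r one n) (⊛-identityˡ r n))
    where
    one : uCoeff 1+zu 0 ≐ cst 1ℚ
    one m = trans (cong (cst 1ℚ m +_) (trans (uCoeff-lift-⊛₂ zS uB 0 m) (⊛-vanishʳ zS _ uCoeff-uB-zero m)))
                  (ℚₚ.+-identityʳ _)
  rhs (suc k) n = trans (uCoeff-⊛₂-lift 1+zu r (suc k) n) (⊛-congʳ r zε n)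
    where
    zε : uCoeff 1+zu (suc k) ≐ zS ⊛ ε k
    zε m = trans (ℚₚ.+-identityˡ _) (trans (uCoeff-lift-⊛₂ zS uB (suc k) m) (⊛-congˡ zS (uCoeff-uB-suc k) m))

open Counting using (Last; none; up; flat; down; countEnding; countM-split; countEnding-none;
                     countEnding-up-zero; countEnding-up-suc; countEnding-flat; countEnding-down)

-- With a successor numerator, mkℚ (+ suc m) 0 _ + 1ℚ reduces to ℕtoℚ (suc m * 1 + 1) by computation.
ℕtoℚ-suc : ∀ n → ℕtoℚ (suc n) ≡ ℕtoℚ n + 1ℚ
ℕtoℚ-suc zero    = refl
ℕtoℚ-suc (suc m) = begin
  ℕtoℚ (suc (suc m))
    ≡⟨ cong ℕtoℚ (trans (ℕₚ.+-comm 1 (suc m)) (cong (ℕ._+ 1) (sym (ℕₚ.*-identityʳ (suc m))))) ⟩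
  ℕtoℚ (suc m ℕ.* 1 ℕ.+ 1)
    ≡⟨⟩
  mkℚ (ℤ.+ suc m) 0 coprime + 1ℚ
    ≡⟨ cong (_+ 1ℚ) (sym (ℚₚ.normalize-coprime coprime)) ⟩
  ℕtoℚ (suc m) + 1ℚ ∎
  where
  open ≡-Reasoning
  coprime : Coprime (suc m) 1
  coprime = Coprime.sym (Coprime.1-coprimeTo (suc m))

ℕtoℚ-+ : ∀ a b → ℕtoℚ (a ℕ.+ b) ≡ ℕtoℚ a + ℕtoℚ b
ℕtoℚ-+ zero    b = sym (ℚₚ.+-identityˡ (ℕtoℚ b))
ℕtoℚ-+ (suc a) b = begin
  ℕtoℚ (suc (a ℕ.+ b))            ≡⟨ ℕtoℚ-suc (a ℕ.+ b) ⟩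
  ℕtoℚ (a ℕ.+ b) + 1ℚ             ≡⟨ cong (_+ 1ℚ) (ℕtoℚ-+ a b) ⟩
  ℕtoℚ a + ℕtoℚ b + 1ℚ            ≡⟨ ℚ-Solver.solve 3 (λ x y o → x :+ y :+ o := x :+ o :+ y) refl (ℕtoℚ a) (ℕtoℚ b) 1ℚ ⟩
  ℕtoℚ a + 1ℚ + ℕtoℚ b            ≡⟨ cong (_+ ℕtoℚ b) (sym (ℕtoℚ-suc a)) ⟩
  ℕtoℚ (suc a) + ℕtoℚ b           ∎
  where
  open ≡-Reasoning
  open ℚ-Solver using (_:+_; _:=_)

ℕtoℚ-+₃ : ∀ a b c → ℕtoℚ (a ℕ.+ b ℕ.+ c) ≡ ℕtoℚ a + ℕtoℚ b + ℕtoℚ c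
ℕtoℚ-+₃ a b c = trans (ℕtoℚ-+ (a ℕ.+ b) c) (cong (_+ ℕtoℚ c) (ℕtoℚ-+ a b))

≐zS⊛ : ∀ {f} g → f 0 ≡ 0ℚ → (∀ n → f (suc n) ≡ g n) → f ≐ zS ⊛ g
≐zS⊛ g f₀≡0 f-suc zero    = trans f₀≡0 (sym (zS⊛-zero g))
≐zS⊛ g f₀≡0 f-suc (suc n) = trans (f-suc n) (sym (zS⊛-suc g n))

Ending : Last → ℕ → FPS
Ending x k n = ℕtoℚ (countEnding n k x)

S : ℕ → FPS
S = uCoeff Sgf

S-split : ∀ k → S k ≐ Ending none k ⊕ Ending up k ⊕ Ending flat k ⊕ Ending down k
S-split k n = trans (cong ℕtoℚ (countM-split n k))
  (trans (ℕtoℚ-+ (c none ℕ.+ c up ℕ.+ c flat) (c down))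
         (cong (_+ ℕtoℚ (c down)) (ℕtoℚ-+₃ (c none) (c up) (c flat))))
  where
  c : Last → ℕ
  c x = countEnding n k x

Ending-none : ∀ k → Ending none k ≐ ε k
Ending-none zero    zero    = refl
Ending-none (suc k) zero    = refl
Ending-none zero    (suc n) = cong ℕtoℚ (countEnding-none n 0)
Ending-none (suc k) (suc n) = cong ℕtoℚ (countEnding-none n (suc k))

Ending-flat : ∀ k → Ending flat k ≐ zS ⊛ S k
Ending-flat k = ≐zS⊛ (S k) refl λ n → cong ℕtoℚ (countEnding-flat n k)

Ending-down : ∀ k → Ending down k ≐ zS ⊛ 1-z ⊛ S (suc k)
Ending-down k = ≐-trans (≐zS⊛ (Ending none (suc k) ⊕ Ending up (suc k) ⊕ Ending down (suc k)) refl λ n →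
    trans (cong ℕtoℚ (countEnding-down n k))
          (ℕtoℚ-+₃ (countEnding n (suc k) none) (countEnding n (suc k) up) (countEnding n (suc k) down)))
  (≐-trans (⊛-congˡ zS not-flat)
           (solve 2 (λ z s → z :* (s :- z :* s) := z :* (con 1ℚ :- z) :* s) ≐-refl zS (S (suc k))))
  where
  open FPS-Solver
  not-flat : Ending none (suc k) ⊕ Ending up (suc k) ⊕ Ending down (suc k) ≐ S (suc k) ⊖ zS ⊛ S (suc k)
  not-flat = ≐-trans (solve 4 (λ e a b d → e :+ a :+ d := e :+ a :+ b :+ d :- b) ≐-refl
                       (Ending none (suc k)) (Ending up (suc k)) (Ending flat (suc k)) (Ending down (suc k)))
                     (λ n → cong₂ _-_ (sym (S-split (suc k) n)) (Ending-flat (suc k) n))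

Ending-up : ∀ k → Ending up k ≐ endingWithU S k
Ending-up zero    zero    = refl
Ending-up zero    (suc n) = cong ℕtoℚ (countEnding-up-zero n)
Ending-up (suc k) = ≐-trans (≐zS⊛ (Ending none k ⊕ Ending flat k ⊕ Ending down k) refl λ n →
    trans (cong ℕtoℚ (countEnding-up-suc n k))
          (ℕtoℚ-+₃ (countEnding n k none) (countEnding n k flat) (countEnding n k down)))
  (⊛-congˡ zS (⊕-cong (⊕-cong (Ending-none k) (Ending-flat k)) (Ending-down k)))

S-lastStepEquations : LastStepEquations S
S-lastStepEquations k = ≐-trans (S-split k)
  (⊕-cong (⊕-cong (⊕-cong (Ending-none k) (Ending-up k)) (Ending-flat k)) (Ending-down k))

mainTheorem12 : (W r₁ : FPS) → IsW W → IsR1 W r₁ →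
    ((n k : ℕ) →
      (lift zS ⊛₂ Sgf ⊛₂ (lift (cst 1ℚ) ⊖₂ lift zS ⊖₂ uB ⊛₂ lift zS ⊛₂ lift r₁)) n k
        ≡ ((lift (cst 1ℚ) ⊕₂ lift zS ⊛₂ uB) ⊛₂ lift r₁) n k)
    × ((j : ℕ) → 1 ≤ j → (n : ℕ) →
      (zS ⊛ zS ⊛ (λ m → Sgf m j)) n
        ≡ (((zS ⊛ r₁ ⊛ geom) ^S (suc j)) ⊕ zS ⊛ ((zS ⊛ r₁ ⊛ geom) ^S j)) n)
mainTheorem12 W r₁ isW isR1 = functional-equation Sgf r₁ solution , level-generating-function
  where
  solution : KernelSolution S r₁
  solution = kernel-method S r₁ (kernel-root W r₁ isW isR1) S-lastStepEquations
  level-generating-function : (j : ℕ) → 1 ≤ j → (n : ℕ) →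
    (zS ⊛ zS ⊛ S j) n ≡ (((zS ⊛ r₁ ⊛ geom) ^S (suc j)) ⊕ zS ⊛ ((zS ⊛ r₁ ⊛ geom) ^S j)) n
  level-generating-function (suc i) _ = level-formula {S} solution i
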